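{- Let $A$ and $H$ be atoms such that the pair $(A,H)$ is linear, and suppose $A$ and $H$ are unifiable. Then for any most general unifier $\theta$ of $A$ and $H$, the atom $A\theta$ is linear. Moreover, if $B$ is an atom such that each of the pairs $(A,H)$ and $(B,H)$ is linear, and $\theta$ is a most general unifier of $A$ and $H$, then $B\theta$ is linear.
   Context: An expression (term, atom, tuple of terms or atoms, or equation), a set of equations, or a substitution is called linear if no variable occurs in it more than once. In particular a pair $(A,H)$ of atoms is linear if no variable occurs more than once in $A$ and $H$ taken together. -}

module Defs where

open import Data.Nat using (ℕ)
open import Data.List using (List; []; _∷_; _++_)
open import Data.List.Relation.Unary.Unique.Propositional using (Unique)
open import Relation.Binary.PropositionalEquality using (_≡_)
open import Data.Product using (Σ; ∃; _×_)

-- First-order terms over a set F of function symbols; variables are natural numbers.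
-- Arguments are lists (arity is not enforced; this only enlarges the term universe).
data Term (F : Set) : Set where
  var : ℕ → Term F
  fn  : F → List (Term F) → Term F

data Atom (F P : Set) : Set where
  atom : P → List (Term F) → Atom F P

-- Substitutions: maps from variables to terms
-- (finite substitutions are those that are the identity almost everywhere).
Subst : Set → Set
Subst F = ℕ → Term F

mutual
  _[_]ₜ : {F : Set} → Term F → Subst F → Term F
  var x    [ σ ]ₜ = σ x
  fn f ts  [ σ ]ₜ = fn f (ts [ σ ]ₜₛ)

  _[_]ₜₛ : {F : Set} → List (Term F) → Subst F → List (Term F)
  []       [ σ ]ₜₛ = []
  (t ∷ ts) [ σ ]ₜₛ = (t [ σ ]ₜ) ∷ (ts [ σ ]ₜₛ)

_[_]ₐ : {F P : Set} → Atom F P → Subst F → Atom F P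
atom p ts [ σ ]ₐ = atom p (ts [ σ ]ₜₛ)

-- Composition: (θ ∘ₛ η) x = (θ x) η, so that t (θ ∘ₛ η) = (t θ) η.
_∘ₛ_ : {F : Set} → Subst F → Subst F → Subst F
(θ ∘ₛ η) x = θ x [ η ]ₜ

Unifier : {F P : Set} → Atom F P → Atom F P → Subst F → Set
Unifier A H σ = A [ σ ]ₐ ≡ H [ σ ]ₐ

Unifiable : {F P : Set} → Atom F P → Atom F P → Set
Unifiable {F} A H = Σ (Subst F) (Unifier A H)

MoreGeneral : {F : Set} → Subst F → Subst F → Set
MoreGeneral {F} θ σ = Σ (Subst F) λ η → ∀ x → σ x ≡ (θ ∘ₛ η) x

MGU : {F P : Set} → Atom F P → Atom F P → Subst F → Set
MGU A H θ = Unifier A H θ × (∀ σ → Unifier A H σ → MoreGeneral θ σ)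

mutual
  varsₜ : {F : Set} → Term F → List ℕ
  varsₜ (var x)   = x ∷ []
  varsₜ (fn f ts) = varsₜₛ ts

  varsₜₛ : {F : Set} → List (Term F) → List ℕ
  varsₜₛ []       = []
  varsₜₛ (t ∷ ts) = varsₜ t ++ varsₜₛ ts

varsₐ : {F P : Set} → Atom F P → List ℕ
varsₐ (atom p ts) = varsₜₛ ts

LinearAtom : {F P : Set} → Atom F P → Set
LinearAtom A = Unique (varsₐ A)

LinearPair : {F P : Set} → Atom F P → Atom F P → Set
LinearPair A H = Unique (varsₐ A ++ varsₐ H)

-- Traversing the argument lists of a linear pair (A , H) side by side produces one binding
-- x ↦ u for every variable occurrence x that meets a subterm u on the other side. By
-- linearity these bindings share no variables, so reading them as a substitution σ gives an
-- explicit unifier with τ = σ τ for every unifier τ. Every variable of B lies outside H, so σ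
-- either fixes it or sends it to a subterm of H, and distinct variables of B receive terms
-- with disjoint variables: B σ is linear. Finally, an arbitrary most general unifier θ
-- satisfies θ = σ θ and σ = θ η, so (B σ) θ η = B σ: θ acts on the variables of B σ as an
-- injective renaming, and B θ = (B σ) θ is linear too.
module Submission where

open import Defs
open import Data.Nat using (ℕ; _≟_)
open import Data.Product using (_×_; _,_; proj₁; proj₂; ∃-syntax)
open import Data.Sum using (inj₁; inj₂)
open import Data.Empty using (⊥-elim)
open import Function using (_∘_; id)
open import Relation.Nullary using (yes; no)
open import Relation.Binary.PropositionalEquality
open import Data.List using (List; []; _∷_; _++_; map; concatMap)
open import Data.List.Properties using (++-assoc; ++-identityʳ; map-++; concatMap-++; ∷-injective)
open import Data.List.Membership.Propositional using (_∈_; _∉_; find; lose)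
open import Data.List.Membership.Propositional.Properties using (∈-++⁺ˡ; ∈-++⁺ʳ; ∈-++⁻; ∈-concatMap⁺; ∈-concatMap⁻)
open import Data.List.Relation.Unary.Any using (here; there)
import Data.List.Relation.Unary.All as All
import Data.List.Relation.Unary.All.Properties as All
import Data.List.Relation.Unary.AllPairs as AllPairs
open import Data.List.Relation.Unary.Unique.Propositional using (Unique; []; _∷_)
open import Data.List.Relation.Unary.Unique.Propositional.Properties using (++⁺; map⁻; Unique[x∷xs]⇒x∉xs)
open import Data.List.Relation.Binary.Disjoint.Propositional using (Disjoint)
open import Data.List.Relation.Binary.Subset.Propositional using (_⊆_)
open import Data.List.Relation.Binary.Permutation.Propositional using (_↭_; ↭-refl; ↭-trans; ↭-sym; ↭-reflexive; ↭⇒↭ₛ; module PermutationReasoning)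
open import Data.List.Relation.Binary.Permutation.Propositional.Properties using (++-comm; ++⁺ˡ; shifts) renaming (++⁺ to ↭-++⁺)
open import Data.List.Relation.Binary.Permutation.Setoid.Properties (setoid ℕ) using (Unique-resp-↭)

private
  variable
    A B F P : Set
    x y z : A
    xs ys zs xs₁ xs₂ ys₁ ys₂ : List A

Unique-++⁻ : ∀ (xs : List A) {ys} → Unique (xs ++ ys) → Unique xs × Unique ys × Disjoint xs ys
Unique-++⁻ []       u          = [] , u , λ ()
Unique-++⁻ (x ∷ xs) (x∉ ∷ u) with Unique-++⁻ xs u
... | u-xs , u-ys , xs#ys = All.++⁻ˡ xs x∉ ∷ u-xs , u-ys , λ where
  (here refl , x∈ys) → All.lookup x∉ (∈-++⁺ʳ xs x∈ys) refl
  (there z∈xs , z∈ys) → xs#ys (z∈xs , z∈ys)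

module _ (f : A → List B) where

  Unique-concatMap⁺ : Unique xs → (∀ {x} → x ∈ xs → Unique (f x)) →
    (∀ {x y} → x ∈ xs → y ∈ xs → x ≢ y → Disjoint (f x) (f y)) → Unique (concatMap f xs)
  Unique-concatMap⁺ {xs = []}     _          _    _    = []
  Unique-concatMap⁺ {xs = x ∷ xs} (x∉ ∷ u) u-f f# =
    ++⁺ (u-f (here refl)) (Unique-concatMap⁺ u (u-f ∘ there) (λ p q → f# (there p) (there q))) head#tail
    where
      head#tail : Disjoint (f x) (concatMap f xs)
      head#tail (z∈fx , z∈tail) with find (∈-concatMap⁻ f z∈tail)
      ... | y , y∈xs , z∈fy = f# (here refl) (there y∈xs) (All.lookup x∉ y∈xs) (z∈fx , z∈fy)

  Unique-concatMap⁻ : Unique (concatMap f xs) → x ∈ xs → Unique (f x)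
  Unique-concatMap⁻ {xs = y ∷ _} u x∈ with Unique-++⁻ (f y) u | x∈
  ... | u-fy , _      , _ | here refl = u-fy
  ... | _    , u-rest , _ | there x∈′ = Unique-concatMap⁻ u-rest x∈′

  Unique-concatMap-shared : Unique (concatMap f xs) → x ∈ xs → y ∈ xs → z ∈ f x → z ∈ f y → x ≡ y
  Unique-concatMap-shared {xs = w ∷ _} u x∈ y∈ z∈fx z∈fy with Unique-++⁻ (f w) u | x∈ | y∈
  ... | _ | here refl | here refl = refl
  ... | _ , _ , w#rest | here refl | there y∈′ = ⊥-elim (w#rest (z∈fx , ∈-concatMap⁺ f (lose y∈′ z∈fy)))
  ... | _ , _ , w#rest | there x∈′ | here refl = ⊥-elim (w#rest (z∈fy , ∈-concatMap⁺ f (lose x∈′ z∈fx)))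
  ... | _ , u-rest , _ | there x∈′ | there y∈′ = Unique-concatMap-shared u-rest x∈′ y∈′ z∈fx z∈fy

infix 4 _⊑_
_⊑_ : List A → List A → Set
xs ⊑ ys = ∃[ ws ] xs ++ ws ↭ ys

↭⇒⊑ : xs ↭ ys → xs ⊑ ys
↭⇒⊑ {xs = xs} p = [] , ↭-trans (↭-reflexive (++-identityʳ xs)) p

[]⊑ : [] ⊑ ys
[]⊑ {ys = ys} = ys , ↭-refl

⊑-↭-trans : xs ⊑ ys → ys ↭ zs → xs ⊑ zs
⊑-↭-trans (ws , p) q = ws , ↭-trans p q

++-interchange : ∀ (xs₁ xs₂ ys₁ ys₂ : List A) → (xs₁ ++ xs₂) ++ ys₁ ++ ys₂ ↭ (xs₁ ++ ys₁) ++ xs₂ ++ ys₂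
++-interchange xs₁ xs₂ ys₁ ys₂ = begin
  (xs₁ ++ xs₂) ++ ys₁ ++ ys₂  ≡⟨ ++-assoc xs₁ xs₂ (ys₁ ++ ys₂) ⟩
  xs₁ ++ xs₂ ++ ys₁ ++ ys₂    ↭⟨ ++⁺ˡ xs₁ (shifts xs₂ ys₁) ⟩
  xs₁ ++ ys₁ ++ xs₂ ++ ys₂    ≡⟨ ++-assoc xs₁ ys₁ (xs₂ ++ ys₂) ⟨
  (xs₁ ++ ys₁) ++ xs₂ ++ ys₂  ∎
  where open PermutationReasoning

⊑-++ : xs₁ ⊑ ys₁ → xs₂ ⊑ ys₂ → xs₁ ++ xs₂ ⊑ ys₁ ++ ys₂
⊑-++ {xs₁ = xs₁} {xs₂ = xs₂} (ws₁ , p₁) (ws₂ , p₂) =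
  ws₁ ++ ws₂ , ↭-trans (++-interchange xs₁ xs₂ ws₁ ws₂) (↭-++⁺ p₁ p₂)

Unique-⊑ : {xs ys : List ℕ} → xs ⊑ ys → Unique ys → Unique xs
Unique-⊑ {xs = xs} (ws , p) u = proj₁ (Unique-++⁻ xs (Unique-resp-↭ (↭⇒↭ₛ (↭-sym p)) u))

private
  variable
    ts : List (Term F)
    σ τ θ η : Subst F

mutual
  subst-congₜ : σ ≗ τ → ∀ t → t [ σ ]ₜ ≡ t [ τ ]ₜ
  subst-congₜ σ≗τ (var x)   = σ≗τ x
  subst-congₜ σ≗τ (fn f ts) = cong (fn f) (subst-congₜₛ σ≗τ ts)

  subst-congₜₛ : σ ≗ τ → ∀ ts → ts [ σ ]ₜₛ ≡ ts [ τ ]ₜₛ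
  subst-congₜₛ σ≗τ []       = refl
  subst-congₜₛ σ≗τ (t ∷ ts) = cong₂ _∷_ (subst-congₜ σ≗τ t) (subst-congₜₛ σ≗τ ts)

mutual
  subst-∘ₜ : ∀ t → (t [ σ ]ₜ) [ τ ]ₜ ≡ t [ σ ∘ₛ τ ]ₜ
  subst-∘ₜ (var x)   = refl
  subst-∘ₜ (fn f ts) = cong (fn f) (subst-∘ₜₛ ts)

  subst-∘ₜₛ : ∀ ts → (ts [ σ ]ₜₛ) [ τ ]ₜₛ ≡ ts [ σ ∘ₛ τ ]ₜₛ
  subst-∘ₜₛ []       = refl
  subst-∘ₜₛ (t ∷ ts) = cong₂ _∷_ (subst-∘ₜ t) (subst-∘ₜₛ ts)

mutual
  subst-idₜ : ∀ t → (∀ {x} → x ∈ varsₜ t → σ x ≡ var x) → t [ σ ]ₜ ≡ t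
  subst-idₜ (var x)   σ-id = σ-id (here refl)
  subst-idₜ (fn f ts) σ-id = cong (fn f) (subst-idₜₛ ts σ-id)

  subst-idₜₛ : ∀ ts → (∀ {x} → x ∈ varsₜₛ ts → σ x ≡ var x) → ts [ σ ]ₜₛ ≡ ts
  subst-idₜₛ []       σ-id = refl
  subst-idₜₛ (t ∷ ts) σ-id =
    cong₂ _∷_ (subst-idₜ t (σ-id ∘ ∈-++⁺ˡ)) (subst-idₜₛ ts (σ-id ∘ ∈-++⁺ʳ (varsₜ t)))

mutual
  vars-substₜ : ∀ t → varsₜ (t [ σ ]ₜ) ≡ concatMap (varsₜ ∘ σ) (varsₜ t)
  vars-substₜ (var x)   = sym (++-identityʳ _)
  vars-substₜ (fn f ts) = vars-substₜₛ ts

  vars-substₜₛ : ∀ ts → varsₜₛ (ts [ σ ]ₜₛ) ≡ concatMap (varsₜ ∘ σ) (varsₜₛ ts)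
  vars-substₜₛ []       = refl
  vars-substₜₛ {σ = σ} (t ∷ ts) = begin
    varsₜ (t [ σ ]ₜ) ++ varsₜₛ (ts [ σ ]ₜₛ)
      ≡⟨ cong₂ _++_ (vars-substₜ t) (vars-substₜₛ ts) ⟩
    concatMap (varsₜ ∘ σ) (varsₜ t) ++ concatMap (varsₜ ∘ σ) (varsₜₛ ts)
      ≡⟨ concatMap-++ (varsₜ ∘ σ) (varsₜ t) (varsₜₛ ts) ⟨
    concatMap (varsₜ ∘ σ) (varsₜ t ++ varsₜₛ ts) ∎
    where open ≡-Reasoning

fn-injective : ∀ {f g : F} {ts ss} → fn f ts ≡ fn g ss → f ≡ g × ts ≡ ss
fn-injective refl = refl , refl

-- Junk value 0 on non-variables.
varName : Term F → ℕ
varName (var x)  = x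
varName (fn _ _) = 0

mutual
  retract-varsₜ : ∀ t → (t [ θ ]ₜ) [ η ]ₜ ≡ t → map (varName ∘ η) (varsₜ (t [ θ ]ₜ)) ≡ varsₜ t
  retract-varsₜ {θ = θ} (var x) e with θ x
  ... | var y = cong (λ u → varName u ∷ []) e
  retract-varsₜ (var x) () | fn _ _
  retract-varsₜ (fn f ts) e = retract-varsₜₛ ts (proj₂ (fn-injective e))

  retract-varsₜₛ : ∀ ts → (ts [ θ ]ₜₛ) [ η ]ₜₛ ≡ ts → map (varName ∘ η) (varsₜₛ (ts [ θ ]ₜₛ)) ≡ varsₜₛ ts
  retract-varsₜₛ []       e = refl
  retract-varsₜₛ {θ = θ} {η = η} (t ∷ ts) e with ∷-injective e
  ... | e-t , e-ts = trans (map-++ (varName ∘ η) (varsₜ (t [ θ ]ₜ)) (varsₜₛ (ts [ θ ]ₜₛ)))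
                           (cong₂ _++_ (retract-varsₜ t e-t) (retract-varsₜₛ ts e-ts))

Unique-vars-retract : (ts [ θ ]ₜₛ) [ η ]ₜₛ ≡ ts → Unique (varsₜₛ ts) → Unique (varsₜₛ (ts [ θ ]ₜₛ))
Unique-vars-retract {ts = ts} e u = map⁻ (subst Unique (sym (retract-varsₜₛ ts e)) u)

Unique-vars-transfer : θ ≗ σ ∘ₛ θ → σ ≗ θ ∘ₛ η →
  ∀ us → Unique (varsₜₛ (us [ σ ]ₜₛ)) → Unique (varsₜₛ (us [ θ ]ₜₛ))
Unique-vars-transfer {θ = θ} {σ = σ} {η = η} θ≗σθ σ≗θη us u =
  subst (Unique ∘ varsₜₛ) σθ≡θ (Unique-vars-retract retract u)
  where
    open ≡-Reasoning

    σθ≡θ : (us [ σ ]ₜₛ) [ θ ]ₜₛ ≡ us [ θ ]ₜₛ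
    σθ≡θ = trans (subst-∘ₜₛ us) (sym (subst-congₜₛ θ≗σθ us))

    retract : ((us [ σ ]ₜₛ) [ θ ]ₜₛ) [ η ]ₜₛ ≡ us [ σ ]ₜₛ
    retract = begin
      ((us [ σ ]ₜₛ) [ θ ]ₜₛ) [ η ]ₜₛ  ≡⟨ cong (_[ η ]ₜₛ) σθ≡θ ⟩
      (us [ θ ]ₜₛ) [ η ]ₜₛ            ≡⟨ subst-∘ₜₛ us ⟩
      us [ θ ∘ₛ η ]ₜₛ                 ≡⟨ subst-congₜₛ σ≗θη us ⟨
      us [ σ ]ₜₛ                      ∎

Binding : Set → Set
Binding F = ℕ × Term F

bvars : Binding F → List ℕ
bvars (v , u) = v ∷ varsₜ u

Independent : List (Binding F) → Set
Independent L = Unique (concatMap bvars L)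

toSubst : List (Binding F) → Subst F
toSubst []            x = var x
toSubst ((v , u) ∷ L) x with x ≟ v
... | yes _ = u
... | no _  = toSubst L x

data Lookup (L : List (Binding F)) (x : ℕ) : Term F → Set where
  unbound : (∀ u → (x , u) ∉ L) → Lookup L x (var x)
  bound   : ∀ {u} → (x , u) ∈ L → Lookup L x u

lookup-there : ∀ {L : List (Binding F)} {x v u t} → x ≢ v → Lookup L x t → Lookup ((v , u) ∷ L) x t
lookup-there x≢v (unbound x∉L) = unbound λ where
  _ (here refl) → x≢v refl
  u (there x∈L) → x∉L u x∈L
lookup-there x≢v (bound x∈L) = bound (there x∈L)

toSubst-view : ∀ (L : List (Binding F)) x → Lookup L x (toSubst L x)
toSubst-view []            x = unbound λ _ ()
toSubst-view ((v , u) ∷ L) x with x ≟ v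
... | yes refl = bound (here refl)
... | no x≢v   = lookup-there x≢v (toSubst-view L x)

toSubst-mostGeneral : ∀ {L : List (Binding F)} → (∀ {v u} → (v , u) ∈ L → τ v ≡ u [ τ ]ₜ) → τ ≗ toSubst L ∘ₛ τ
toSubst-mostGeneral {L = L} τ-sound x with toSubst L x | toSubst-view L x
... | _ | unbound _ = refl
... | _ | bound x∈L = τ-sound x∈L

independent-shared : ∀ {L : List (Binding F)} {b b′ z} → Independent L → b ∈ L → b′ ∈ L → z ∈ bvars b → z ∈ bvars b′ → b ≡ b′
independent-shared = Unique-concatMap-shared bvars

toSubst-bound : ∀ {L : List (Binding F)} {v u} → Independent L → (v , u) ∈ L → toSubst L v ≡ u
toSubst-bound {L = L} {v} ind v∈L with toSubst L v | toSubst-view L v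
... | _ | unbound v∉L = ⊥-elim (v∉L _ v∈L)
... | _ | bound v∈L′ = cong proj₂ (independent-shared ind v∈L′ v∈L (here refl) (here refl))

toSubst-fixes-rhs : ∀ {L : List (Binding F)} {v u} → Independent L → (v , u) ∈ L → u [ toSubst L ]ₜ ≡ u
toSubst-fixes-rhs {L = L} {v} {u} ind v∈L = subst-idₜ u fixed
  where
    fixed : ∀ {z} → z ∈ varsₜ u → toSubst L z ≡ var z
    fixed {z} z∈u with toSubst L z | toSubst-view L z
    ... | _ | unbound _ = refl
    ... | _ | bound z∈L = ⊥-elim (Unique[x∷xs]⇒x∉xs (Unique-concatMap⁻ bvars ind v∈L) (subst (_∈ varsₜ u) z≡v z∈u))
      where
        z≡v : z ≡ v
        z≡v = cong proj₁ (sym (independent-shared ind v∈L z∈L (there z∈u) (here refl)))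

toSubst-linear : ∀ {L : List (Binding F)} → Independent L → ∀ x → Unique (varsₜ (toSubst L x))
toSubst-linear {L = L} ind x with toSubst L x | toSubst-view L x
... | _ | unbound _ = All.[] ∷ []
... | _ | bound x∈L = AllPairs.tail (Unique-concatMap⁻ bvars ind x∈L)

toSubst-disjoint : ∀ {L : List (Binding F)} {V : List ℕ} {x y} → Independent L →
  (∀ {v u} → (v , u) ∈ L → v ∉ V → varsₜ u ⊆ V) →
  x ∉ V → y ∉ V → x ≢ y → Disjoint (varsₜ (toSubst L x)) (varsₜ (toSubst L y))
toSubst-disjoint {L = L} {x = x} {y} ind rhs⊆V x∉V y∉V x≢y
  with toSubst L x | toSubst-view L x | toSubst L y | toSubst-view L y
... | _ | unbound _   | _ | unbound _   = λ { (here refl , here refl) → x≢y refl }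
... | _ | bound x∈L   | _ | unbound _   = λ { (z∈u , here refl) → y∉V (rhs⊆V x∈L x∉V z∈u) }
... | _ | unbound _   | _ | bound y∈L   = λ { (here refl , z∈u) → x∉V (rhs⊆V y∈L y∉V z∈u) }
... | _ | bound x∈L   | _ | bound y∈L   =
  λ (z∈u , z∈u′) → x≢y (cong proj₁ (independent-shared ind x∈L y∈L (there z∈u) (there z∈u′)))

-- Function symbols and arities are not compared: bindings are only formed for unifiable pairs.
mutual
  bindsₜ : Term F → Term F → List (Binding F)
  bindsₜ (var v)   s         = (v , s) ∷ []
  bindsₜ (fn f ts) (var w)   = (w , fn f ts) ∷ []
  bindsₜ (fn f ts) (fn g ss) = bindsₜₛ ts ss

  bindsₜₛ : List (Term F) → List (Term F) → List (Binding F)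
  bindsₜₛ (t ∷ ts) (s ∷ ss) = bindsₜ t s ++ bindsₜₛ ts ss
  bindsₜₛ _        _        = []

mutual
  toSubst-unifiesₜ : ∀ {L : List (Binding F)} t s → Independent L → t [ τ ]ₜ ≡ s [ τ ]ₜ →
    bindsₜ t s ⊆ L → t [ toSubst L ]ₜ ≡ s [ toSubst L ]ₜ
  toSubst-unifiesₜ (var v) s ind _ ⊆L =
    trans (toSubst-bound ind (⊆L (here refl))) (sym (toSubst-fixes-rhs ind (⊆L (here refl))))
  toSubst-unifiesₜ (fn f ts) (var w) ind _ ⊆L =
    trans (toSubst-fixes-rhs ind (⊆L (here refl))) (sym (toSubst-bound ind (⊆L (here refl))))
  toSubst-unifiesₜ (fn f ts) (fn g ss) ind e ⊆L with fn-injective e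
  ... | refl , e-args = cong (fn f) (toSubst-unifiesₜₛ ts ss ind e-args ⊆L)

  toSubst-unifiesₜₛ : ∀ {L : List (Binding F)} ts ss → Independent L → ts [ τ ]ₜₛ ≡ ss [ τ ]ₜₛ →
    bindsₜₛ ts ss ⊆ L → ts [ toSubst L ]ₜₛ ≡ ss [ toSubst L ]ₜₛ
  toSubst-unifiesₜₛ []       []       _   _ _  = refl
  toSubst-unifiesₜₛ (t ∷ ts) (s ∷ ss) ind e ⊆L with ∷-injective e
  ... | e-t , e-ts = cong₂ _∷_ (toSubst-unifiesₜ t s ind e-t (⊆L ∘ ∈-++⁺ˡ))
                               (toSubst-unifiesₜₛ ts ss ind e-ts (⊆L ∘ ∈-++⁺ʳ (bindsₜ t s)))

mutual
  bindsₜ-sound : ∀ t s → t [ τ ]ₜ ≡ s [ τ ]ₜ → ∀ {v u} → (v , u) ∈ bindsₜ t s → τ v ≡ u [ τ ]ₜ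
  bindsₜ-sound (var v)   s         e (here refl) = e
  bindsₜ-sound (fn f ts) (var w)   e (here refl) = sym e
  bindsₜ-sound (fn f ts) (fn g ss) e v∈L         = bindsₜₛ-sound ts ss (proj₂ (fn-injective e)) v∈L

  bindsₜₛ-sound : ∀ ts ss → ts [ τ ]ₜₛ ≡ ss [ τ ]ₜₛ → ∀ {v u} → (v , u) ∈ bindsₜₛ ts ss → τ v ≡ u [ τ ]ₜ
  bindsₜₛ-sound (t ∷ ts) (s ∷ ss) e v∈L with ∷-injective e | ∈-++⁻ (bindsₜ t s) v∈L
  ... | e-t , _    | inj₁ v∈t  = bindsₜ-sound t s e-t v∈t
  ... | _   , e-ts | inj₂ v∈ts = bindsₜₛ-sound ts ss e-ts v∈ts

mutual
  bindsₜ-⊑ : ∀ t s → concatMap bvars (bindsₜ t s) ⊑ varsₜ {F} t ++ varsₜ s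
  bindsₜ-⊑ (var v)   s         = ↭⇒⊑ (↭-reflexive (++-identityʳ _))
  bindsₜ-⊑ (fn f ts) (var w)   = ↭⇒⊑ (↭-trans (↭-reflexive (++-identityʳ _)) (++-comm (w ∷ []) (varsₜₛ ts)))
  bindsₜ-⊑ (fn f ts) (fn g ss) = bindsₜₛ-⊑ ts ss

  bindsₜₛ-⊑ : ∀ ts ss → concatMap bvars (bindsₜₛ ts ss) ⊑ varsₜₛ {F} ts ++ varsₜₛ ss
  bindsₜₛ-⊑ []       _        = []⊑
  bindsₜₛ-⊑ (_ ∷ _)  []       = []⊑
  bindsₜₛ-⊑ (t ∷ ts) (s ∷ ss) =
    subst (_⊑ varsₜₛ (t ∷ ts) ++ varsₜₛ (s ∷ ss)) (sym (concatMap-++ bvars (bindsₜ t s) (bindsₜₛ ts ss)))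
      (⊑-↭-trans (⊑-++ (bindsₜ-⊑ t s) (bindsₜₛ-⊑ ts ss))
                 (++-interchange (varsₜ t) (varsₜ s) (varsₜₛ ts) (varsₜₛ ss)))

mutual
  bindsₜ-rhs : ∀ t s {v u} → (v , u) ∈ bindsₜ {F} t s → v ∉ varsₜ s → varsₜ u ⊆ varsₜ s
  bindsₜ-rhs (var v)   s         (here refl) _   = id
  bindsₜ-rhs (fn f ts) (var w)   (here refl) w∉w = ⊥-elim (w∉w (here refl))
  bindsₜ-rhs (fn f ts) (fn g ss) v∈L         v∉s = bindsₜₛ-rhs ts ss v∈L v∉s

  bindsₜₛ-rhs : ∀ ts ss {v u} → (v , u) ∈ bindsₜₛ {F} ts ss → v ∉ varsₜₛ ss → varsₜ u ⊆ varsₜₛ ss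
  bindsₜₛ-rhs (t ∷ ts) (s ∷ ss) v∈L v∉ss with ∈-++⁻ (bindsₜ t s) v∈L
  ... | inj₁ v∈t  = ∈-++⁺ˡ ∘ bindsₜ-rhs t s v∈t (v∉ss ∘ ∈-++⁺ˡ)
  ... | inj₂ v∈ts = ∈-++⁺ʳ (varsₜ s) ∘ bindsₜₛ-rhs ts ss v∈ts (v∉ss ∘ ∈-++⁺ʳ (varsₜ s))

canonicalUnifier : List (Term F) → List (Term F) → Subst F
canonicalUnifier ts ss = toSubst (bindsₜₛ ts ss)

module _ (ts ss : List (Term F)) where

  canonicalUnifier-mostGeneral : ts [ τ ]ₜₛ ≡ ss [ τ ]ₜₛ → τ ≗ canonicalUnifier ts ss ∘ₛ τ
  canonicalUnifier-mostGeneral e = toSubst-mostGeneral (bindsₜₛ-sound ts ss e)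

  module _ (linear : Unique (varsₜₛ ts ++ varsₜₛ ss)) where

    bindsₜₛ-independent : Independent (bindsₜₛ ts ss)
    bindsₜₛ-independent = Unique-⊑ (bindsₜₛ-⊑ ts ss) linear

    canonicalUnifier-unifies : ts [ τ ]ₜₛ ≡ ss [ τ ]ₜₛ →
      ts [ canonicalUnifier ts ss ]ₜₛ ≡ ss [ canonicalUnifier ts ss ]ₜₛ
    canonicalUnifier-unifies e = toSubst-unifiesₜₛ ts ss bindsₜₛ-independent e id

    canonicalUnifier-linear : ∀ us → Unique (varsₜₛ us ++ varsₜₛ ss) →
      Unique (varsₜₛ (us [ canonicalUnifier ts ss ]ₜₛ))
    canonicalUnifier-linear us linear-us with Unique-++⁻ (varsₜₛ us) linear-us
    ... | unique-us , _ , us#ss = subst Unique (sym (vars-substₜₛ us))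
      (Unique-concatMap⁺ (varsₜ ∘ canonicalUnifier ts ss) unique-us
        (λ {x} _ → toSubst-linear {L = bindsₜₛ ts ss} bindsₜₛ-independent x)
        (λ x∈us y∈us → toSubst-disjoint bindsₜₛ-independent (bindsₜₛ-rhs ts ss) (outside x∈us) (outside y∈us)))
      where
        outside : ∀ {x} → x ∈ varsₜₛ us → x ∉ varsₜₛ ss
        outside x∈us x∈ss = us#ss (x∈us , x∈ss)

atom-injective : ∀ {p q : P} {ts ss : List (Term F)} → atom p ts ≡ atom q ss → p ≡ q × ts ≡ ss
atom-injective refl = refl , refl

mgu-linear-instance : (A H B : Atom F P) → LinearPair A H → Unifiable A H → LinearPair B H →
  ∀ θ → MGU A H θ → LinearAtom (B [ θ ]ₐ)
mgu-linear-instance (atom p ts) (atom q ss) (atom r us) linear (τ , τ-unifies) linear-B θ (θ-unifies , θ-mgu)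
  with atom-injective τ-unifies
... | p≡q , τ-args with θ-mgu (canonicalUnifier ts ss) (cong₂ atom p≡q (canonicalUnifier-unifies ts ss linear τ-args))
... | η , σ≗θη = Unique-vars-transfer θ≗σθ σ≗θη us (canonicalUnifier-linear ts ss linear us linear-B)
  where
    θ≗σθ : θ ≗ canonicalUnifier ts ss ∘ₛ θ
    θ≗σθ = canonicalUnifier-mostGeneral ts ss (proj₂ (atom-injective θ-unifies))

lemma2 : {F P : Set} (A H : Atom F P) →
    LinearPair A H → Unifiable A H →
    (∀ θ → MGU A H θ → LinearAtom (A [ θ ]ₐ))
    × (∀ (B : Atom F P) θ → LinearPair B H → MGU A H θ → LinearAtom (B [ θ ]ₐ))
lemma2 A H linear unifiable =
  (λ θ → mgu-linear-instance A H A linear unifiable linear θ) ,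
  (λ B θ linear-B → mgu-linear-instance A H B linear unifiable linear-B θ)
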